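{- Let $K_{a,b}$ be the complete bipartite graph with parts of sizes $a$ and $b$, and let $k$ be a positive integer with $k<a\le b$. Then $$b_t^k(K_{a,b})\le ka.$$
   Context: $\gamma_t(K_{a,b})=2$ for $2\le a\le b$. A total dominating set of a graph without isolated vertices is a vertex set $S$ such that every vertex is adjacent to some vertex of $S$; $\gamma_t(G)$ is the minimum size of such a set. The $k$-total bondage number $b_t^k(G)$ is the minimum number of edges that must be deleted from $G$ so that the resulting graph (required to have no isolated vertices) has total domination number at least $\gamma_t(G)+k$. -}

module Defs where

open import Data.Nat using (ℕ; _+_; _*_; _≤_; _<_)
open import Data.Fin using (Fin)
open import Data.Sum using (_⊎_; inj₁; inj₂)
open import Data.Product using (_×_; _,_; ∃)
open import Data.Empty using (⊥)
open import Data.Unit using (⊤)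
open import Data.List using (List; length)
open import Data.List.Membership.Propositional using (_∈_)
open import Relation.Nullary using (¬_)
open import Relation.Binary.PropositionalEquality using (_≡_)

IsTDS : {V : Set} → (V → V → Set) → List V → Set
IsTDS {V} Adj S = (v : V) → ∃ λ u → (u ∈ S) × Adj v u

NoIsolated : {V : Set} → (V → V → Set) → Set
NoIsolated {V} Adj = (v : V) → ∃ λ u → Adj v u

-- γ_t(G) ≥ m  : every total dominating set has at least m elements
-- (lists with repeated entries are only longer, so this is the usual notion).
TotDomAtLeast : {V : Set} → (V → V → Set) → ℕ → Set
TotDomAtLeast Adj m = ∀ S → IsTDS Adj S → m ≤ length S

IsTotalDomNumber : {V : Set} → (V → V → Set) → ℕ → Set
IsTotalDomNumber Adj g = (∃ λ S → IsTDS Adj S × length S ≡ g) × TotDomAtLeast Adj g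

Vtx : ℕ → ℕ → Set
Vtx a b = Fin a ⊎ Fin b

KAdj : (a b : ℕ) → Vtx a b → Vtx a b → Set
KAdj a b (inj₁ i) (inj₁ j) = ⊥
KAdj a b (inj₁ i) (inj₂ j) = ⊤
KAdj a b (inj₂ i) (inj₁ j) = ⊤
KAdj a b (inj₂ i) (inj₂ j) = ⊥

-- Edges of K_{a,b} are identified with pairs (i , j) : Fin a × Fin b.
-- Adjacency of K_{a,b} minus the edge set D.
DelAdj : {a b : ℕ} → List (Fin a × Fin b) → Vtx a b → Vtx a b → Set
DelAdj D (inj₁ i) (inj₁ j) = ⊥
DelAdj D (inj₁ i) (inj₂ j) = ¬ ((i , j) ∈ D)
DelAdj D (inj₂ i) (inj₁ j) = ¬ ((j , i) ∈ D)
DelAdj D (inj₂ i) (inj₂ j) = ⊥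

-- Colour the vertices x of the part of size a by clamp x = min(x, k) ∈ {0, …, k}, and
-- call the first k + 1 vertices of the part of size b hubs. Deleting every edge x (hub c)
-- with c ≠ clamp x removes exactly k edges at each x and leaves hub c adjacent only to
-- the vertices of colour c. A total dominating set must then contain a vertex of every
-- colour (to dominate the hubs) and also a vertex of the other part, so it has at
-- least k + 2 ≥ γ_t(K_{a,b}) + k elements, because γ_t(K_{a,b}) ≤ 2.
module Submission where

open import Defs
open import Data.Nat using (ℕ; zero; suc; _+_; _*_; _≤_; _<_; s≤s)
open import Data.Nat.Properties using (*-comm; +-monoˡ-≤; ≤-trans; ≤-reflexive)
open import Data.Fin using (Fin; inject≤; punchIn; punchOut; _≟_)
  renaming (zero to fzero; suc to fsuc)
open import Data.Fin.Properties
  using (inject≤-injective; punchIn-injective; punchInᵢ≢i; punchIn-punchOut; injective⇒≤)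
open import Data.Sum.Properties using (inj₁-injective)
open import Data.Product using (_×_; ∃; Σ; _,_; proj₁; proj₂)
open import Data.Sum using (inj₁; inj₂)
open import Data.Unit using (tt)
open import Data.Empty using (⊥-elim)
open import Data.List using (List; []; _∷_; _++_; length; map; lookup; allFin; cartesianProduct)
open import Data.List.Properties using (length-map; length-tabulate; length-++)
open import Data.List.Membership.Propositional using (_∈_)
open import Data.List.Membership.Propositional.Properties
  using (∈-map⁺; ∈-map⁻; ∈-cartesianProduct⁺; ∈-allFin)
open import Data.List.Relation.Unary.Any using (here; there; index)
open import Data.List.Relation.Unary.Any.Properties using (lookup-index)
open import Data.List.Relation.Unary.Unique.Propositional using (Unique)
import Data.List.Relation.Unary.Unique.Propositional.Properties as Unique
open import Relation.Nullary using (yes; no)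
open import Relation.Binary.PropositionalEquality
  using (_≡_; _≢_; refl; sym; trans; cong; cong₂; subst; module ≡-Reasoning)

clamp : ∀ {n} (k : ℕ) → Fin n → Fin (suc k)
clamp zero    _        = fzero
clamp (suc k) fzero    = fzero
clamp (suc k) (fsuc i) = fsuc (clamp k i)

clamp-inject≤ : ∀ {n} k (c : Fin (suc k)) (p : suc k ≤ n) → clamp k (inject≤ c p) ≡ c
clamp-inject≤ zero    fzero    (s≤s _) = refl
clamp-inject≤ (suc k) fzero    (s≤s _) = refl
clamp-inject≤ (suc k) (fsuc c) (s≤s p) = cong fsuc (clamp-inject≤ k c p)

length-cartesianProduct : ∀ {A B : Set} (xs : List A) (ys : List B) →
  length (cartesianProduct xs ys) ≡ length xs * length ys
length-cartesianProduct []       ys = refl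
length-cartesianProduct (x ∷ xs) ys = begin
  length (map (x ,_) ys ++ cartesianProduct xs ys)
    ≡⟨ length-++ (map (x ,_) ys) ⟩
  length (map (x ,_) ys) + length (cartesianProduct xs ys)
    ≡⟨ cong₂ _+_ (length-map (x ,_) ys) (length-cartesianProduct xs ys) ⟩
  length ys + length xs * length ys ∎
  where open ≡-Reasoning

length-allFin : ∀ n → length (allFin n) ≡ n
length-allFin n = length-tabulate {n = n} (λ i → i)

injection⇒≤-length : ∀ {V : Set} {m} (S : List V) (h : Fin m → V) →
  (∀ {i j} → h i ≡ h j → i ≡ j) → (∀ i → h i ∈ S) → m ≤ length S
injection⇒≤-length S h h-inj h∈S = injective⇒≤ {f = λ i → index (h∈S i)} λ {i} {j} eq →
  h-inj (trans (lookup-index (h∈S i)) (trans (cong (lookup S) eq) (sym (lookup-index (h∈S j)))))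

γt-K≤2 : ∀ {a b} → Fin a → Fin b → (g : ℕ) → IsTotalDomNumber (KAdj a b) g → g ≤ 2
γt-K≤2 {a} {b} i j g (_ , minimal) = minimal (inj₁ i ∷ inj₂ j ∷ []) tds
  where
  tds : IsTDS (KAdj a b) (inj₁ i ∷ inj₂ j ∷ [])
  tds (inj₁ _) = inj₂ j , there (here refl) , tt
  tds (inj₂ _) = inj₁ i , here refl , tt

module ClampDeletion (k a b : ℕ) (k<a : k < a) (k<b : k < b) where

  hub : Fin (suc k) → Fin b
  hub c = inject≤ c k<b

  -- The m-th deleted edge at x joins x to the m-th hub other than hub (clamp k x).
  deletedEdge : Fin a × Fin k → Fin a × Fin b
  deletedEdge (x , m) = x , hub (punchIn (clamp k x) m)

  deleted : List (Fin a × Fin b)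
  deleted = map deletedEdge (cartesianProduct (allFin a) (allFin k))

  deletedEdge-injective : ∀ {e f} → deletedEdge e ≡ deletedEdge f → e ≡ f
  deletedEdge-injective {x , m} {_ , m′} eq with cong proj₁ eq
  ... | refl = cong (x ,_) (punchIn-injective (clamp k x) m m′
                 (inject≤-injective k<b k<b _ _ (cong proj₂ eq)))

  ∈-deleted⁻ : ∀ {x y} → (x , y) ∈ deleted → ∃ λ c → y ≡ hub c × c ≢ clamp k x
  ∈-deleted⁻ p with ∈-map⁻ deletedEdge p
  ... | (x , m) , _ , refl = punchIn (clamp k x) m , refl , punchInᵢ≢i (clamp k x) m

  ∈-deleted⁺ : ∀ {x c} → clamp k x ≢ c → (x , hub c) ∈ deleted
  ∈-deleted⁺ {x} {c} x≢c = subst (λ d → (x , hub d) ∈ deleted) (punchIn-punchOut x≢c)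
    (∈-map⁺ deletedEdge (∈-cartesianProduct⁺ (∈-allFin x) (∈-allFin (punchOut x≢c))))

  deleted-unique : Unique deleted
  deleted-unique = Unique.map⁺ deletedEdge-injective
    (Unique.cartesianProduct⁺ (Unique.allFin⁺ a) (Unique.allFin⁺ k))

  length-deleted : length deleted ≡ k * a
  length-deleted = begin
    length deleted
      ≡⟨ length-map deletedEdge (cartesianProduct (allFin a) (allFin k)) ⟩
    length (cartesianProduct (allFin a) (allFin k))
      ≡⟨ length-cartesianProduct (allFin a) (allFin k) ⟩
    length (allFin a) * length (allFin k)
      ≡⟨ cong₂ _*_ (length-allFin a) (length-allFin k) ⟩
    a * k
      ≡⟨ *-comm a k ⟩
    k * a ∎
    where open ≡-Reasoning

  deleted-noIsolated : NoIsolated (DelAdj deleted)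
  deleted-noIsolated (inj₁ x) = inj₂ (hub (clamp k x)) , λ p →
    let (c , eq , c≢x) = ∈-deleted⁻ p in c≢x (sym (inject≤-injective k<b k<b _ _ eq))
  deleted-noIsolated (inj₂ y) = inj₁ (inject≤ (clamp k y) k<a) , λ p →
    let (c , eq , c≢y) = ∈-deleted⁻ p in c≢y (begin
      c                                 ≡⟨ sym (clamp-inject≤ k c k<b) ⟩
      clamp k (hub c)                   ≡⟨ cong (clamp k) (sym eq) ⟩
      clamp k y                         ≡⟨ sym (clamp-inject≤ k (clamp k y) k<a) ⟩
      clamp k (inject≤ (clamp k y) k<a) ∎)
    where open ≡-Reasoning

  module _ (S : List (Vtx a b)) (S-tds : IsTDS (DelAdj deleted) S) where

    -- Only the vertices of colour c remain adjacent to hub c.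
    representative : (c : Fin (suc k)) → Σ (Fin a) λ x → clamp k x ≡ c × inj₁ x ∈ S
    representative c with S-tds (inj₂ (hub c))
    ... | inj₂ _ , _ , ()
    ... | inj₁ x , x∈S , adj with clamp k x ≟ c
    ...   | yes x≡c = x , x≡c , x∈S
    ...   | no  x≢c = ⊥-elim (adj (∈-deleted⁺ x≢c))

    representative-injective : ∀ {c d} →
      proj₁ (representative c) ≡ proj₁ (representative d) → c ≡ d
    representative-injective {c} {d} eq =
      trans (sym (proj₁ (proj₂ (representative c))))
            (trans (cong (clamp k) eq) (proj₁ (proj₂ (representative d))))

    2+k≤length : 2 + k ≤ length S
    2+k≤length with S-tds (inj₁ (inject≤ fzero k<a))
    ... | inj₁ _ , _ , ()
    ... | inj₂ y , y∈S , _ = injection⇒≤-length S h h-injective h∈S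
      where
      h : Fin (2 + k) → Vtx a b
      h fzero    = inj₂ y
      h (fsuc c) = inj₁ (proj₁ (representative c))

      h-injective : ∀ {i j} → h i ≡ h j → i ≡ j
      h-injective {fzero}  {fzero}  _  = refl
      h-injective {fsuc _} {fsuc _} eq = cong fsuc (representative-injective (inj₁-injective eq))

      h∈S : ∀ i → h i ∈ S
      h∈S fzero    = y∈S
      h∈S (fsuc c) = proj₂ (proj₂ (representative c))

theorem3p18 : (k a b : ℕ) → 1 ≤ k → k < a → a ≤ b →
    (g : ℕ) → IsTotalDomNumber (KAdj a b) g →
    ∃ λ (D : List (Fin a × Fin b)) →
      Unique D × length D ≤ k * a × NoIsolated (DelAdj D) × TotDomAtLeast (DelAdj D) (g + k)
theorem3p18 k a b _ k<a a≤b g g-γt =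
  deleted , deleted-unique , ≤-reflexive length-deleted , deleted-noIsolated ,
  λ S S-tds → ≤-trans (+-monoˡ-≤ k g≤2) (2+k≤length S S-tds)
  where
  k<b : k < b
  k<b = ≤-trans k<a a≤b
  open ClampDeletion k a b k<a k<b
  g≤2 : g ≤ 2
  g≤2 = γt-K≤2 (inject≤ fzero k<a) (hub fzero) g g-γt
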